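{- For every graph $F$ with more than one vertex, $E[F]\ge\chi(F)$, where $\chi(F)$ is the chromatic number of $F$.
   Context: Graphs are finite, simple, undirected, loopless. For $k\ge2$, a graph satisfies $\mathrm{EA}_k$ (the $k$-extension property) if for every two disjoint vertex sets $X,Y$ with $|X\cup Y|<k$ there is a vertex $z\notin X\cup Y$ adjacent to all vertices in $X$ and non-adjacent to all vertices in $Y$; $\mathrm{EA}_1$ says the graph is non-empty. Write $F\sqsubset H$ if $H$ contains an induced copy of $F$. The extension index $E[F]$ is the minimum $k$ such that every graph $H$ satisfying $\mathrm{EA}_k$ has $F\sqsubset H$ (equivalently, the maximum $k$ such that some graph $H$ satisfies $\mathrm{EA}_{k-1}$ and $F\not\sqsubset H$). -}

module Defs where

open import Data.Nat using (ℕ; zero; suc; _<_; _≤_)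
open import Data.Bool using (Bool; true; false)
open import Data.Fin using (Fin)
open import Data.Fin.Subset using (Subset; _∈_; _∉_; _∪_; ∣_∣)
open import Data.Product using (Σ; ∃; _×_; _,_)
open import Data.Unit using (⊤)
open import Function.Definitions using (Injective)
open import Relation.Binary.PropositionalEquality using (_≡_; _≢_)
open import Relation.Nullary using (¬_)

record Graph : Set where
  field
    n     : ℕ
    adj   : Fin n → Fin n → Bool
    sym   : ∀ u v → adj u v ≡ adj v u
    loopless : ∀ v → adj v v ≡ false
open Graph public

_⊏_ : Graph → Graph → Set
F ⊏ H = Σ (Fin (n F) → Fin (n H)) λ f →
          Injective _≡_ _≡_ f × (∀ u v → adj H (f u) (f v) ≡ adj F u v)

Disjoint : ∀ {m} → Subset m → Subset m → Set
Disjoint X Y = ∀ x → x ∈ X → x ∉ Y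

EA : ℕ → Graph → Set
EA zero G = ⊤
EA (suc zero) G = Fin (n G)
EA (suc (suc k)) G =
  (X Y : Subset (n G)) → Disjoint X Y → ∣ X ∪ Y ∣ < suc (suc k) →
  ∃ λ z → z ∉ X ∪ Y
        × (∀ x → x ∈ X → adj G x z ≡ true)
        × (∀ y → y ∈ Y → adj G y z ≡ false)

Colourable : ℕ → Graph → Set
Colourable c G = Σ (Fin (n G) → Fin c) λ col →
  ∀ u v → adj G u v ≡ true → col u ≢ col v

IsChromaticNumber : ℕ → Graph → Set
IsChromaticNumber χ G = Colourable χ G × (∀ c → Colourable c G → χ ≤ c)

-- k witnesses the defining property of E[F]: every graph with EA_k contains F.
Forces : ℕ → Graph → Set
Forces k F = ∀ (H : Graph) → EA k H → F ⊏ H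

-- An induced subgraph of a k-colourable graph is k-colourable, so it suffices to construct, for
-- every k, a k-colourable graph with the k-extension property. For k ≥ 2 fix a large prime p and
-- D = 2k. A vertex is a polynomial over ℤ/p of degree D whose leading coefficient 1 + c records its
-- colour class c; let name u = u(0). Vertices u, v of different classes are adjacent iff exactly one
-- of u(v(name u)) and v(u(name v)) vanishes, a symmetric rule. Given fewer than k vertices T and a
-- prescribed pattern on them, choose a class unused by T and a point a avoiding the roots of the
-- nonzero polynomials s - t (s ≠ t in T) and t - x (x = 0 or a name in T): there are fewer than p
-- of them. Interpolation through at most D nodes gives z in the free class with z(0) = z(name t) = a,
-- so that t(z(name t)) = t(a) ≠ 0, and with z(t(a)) = 0 or 1 as prescribed.

module Submission where

open import Data.Bool using (Bool; true; false; _xor_; if_then_else_)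
open import Data.Bool.Properties using (xor-comm)
open import Data.Fin using (Fin; zero; suc; toℕ; fromℕ<; quotient; remainder; combine)
open import Data.Fin.Properties
  using (toℕ-fromℕ<; toℕ<n; toℕ-injective; remQuot-combine; combine-remQuot; all?; ¬∀⟶∃¬; pigeonhole)
import Data.Fin.Properties as Fin
open import Data.Fin.Subset using (Subset; _∪_; ∣_∣) renaming (_∈_ to _∈ₛ_; _∉_ to _∉ₛ_)
open import Data.Fin.Subset.Properties using (x∈p∪q⁺) renaming (_∈?_ to _∈ₛ?_)
open import Data.List using (List; []; _∷_; _++_; [_]; length; lookup; map; concatMap)
open import Data.List.Properties using (length-++; length-map; ∷-injective; ∷ʳ-injective)
open import Data.List.Membership.Propositional using (_∈_; _∉_; find)
open import Data.List.Membership.Propositional.Properties using (∈-map⁺; ∈-map⁻; ∈-++⁻)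
open import Data.List.Relation.Unary.All as All using (All; []; _∷_)
import Data.List.Relation.Unary.All.Properties as All
open import Data.List.Relation.Unary.All.Properties using (All¬⇒¬Any)
open import Data.List.Relation.Unary.Any using (Any; here; there; index; any?)
import Data.List.Relation.Unary.Any.Properties as Any
open import Data.List.Relation.Unary.Any.Properties using (lookup-index)
open import Data.Nat
open import Data.Nat.Properties
open import Data.Nat.Coprimality using (Coprime; coprime-Bézout)
open import Data.Nat.DivMod using (_%_; m%n<n; m%n%n≡m%n; m<n⇒m%n≡m; %-distribˡ-+; %-distribˡ-*; m*n%n≡0)
open import Data.Nat.Divisibility
  using (_∣_; ∣-trans; m∣m*n; m≤n⇒m!∣n!; ∣m+n∣m⇒∣n; ∣1⇒≡1; m%n≡0⇒n∣m; n∣m⇒m%n≡0)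
open import Data.Nat.GCD using (module Bézout)
open import Data.Nat.ListAction using (product)
open import Data.Nat.Primality
  using (Prime; ¬prime[1]; prime⇒nonZero; prime⇒nonTrivial; prime⇒irreducible; euclidsLemma)
open import Data.Nat.Primality.Factorisation using (factorise)
open import Data.Nat.Tactic.RingSolver using (solve-∀)
open import Data.Product using (Σ; ∃; _×_; _,_; proj₁; proj₂)
open import Data.Sum using (_⊎_; inj₁; inj₂; [_,_]′)
open import Data.Unit using (tt)
open import Data.Vec.Base using ([]; _∷_)
import Data.Vec.Base as Vec
open import Function using (_∘_)
open import Level using (0ℓ)
open import Relation.Binary.Bundles using (Setoid)
open import Relation.Binary.Definitions using (Decidable)
open import Relation.Binary.PropositionalEquality hiding ([_])
open import Relation.Binary.Structures using (IsEquivalence)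
import Relation.Binary.Reasoning.Setoid
open import Relation.Nullary using (¬_; yes; no; does; contradiction)
open import Relation.Nullary.Decidable using (map′; dec-true; dec-false)
open import Defs using (Graph; n; _⊏_; EA; Colourable; IsChromaticNumber; Forces; Disjoint)

∃-∉ : ∀ {n} (xs : List (Fin n)) → length xs < n → ∃ λ i → i ∉ xs
∃-∉ {n} xs short with all? (λ i → any? (i Fin.≟_) xs)
... | no ¬all = ¬∀⟶∃¬ n (_∈ xs) (λ i → any? (i Fin.≟_) xs) ¬all
... | yes all with pigeonhole short (λ i → index (all i))
...   | i , j , i<j , same = contradiction
          (trans (lookup-index (all i)) (trans (cong (lookup xs) same) (sym (lookup-index (all j)))))
          (Fin.<⇒≢ i<j)

∣n! : ∀ {m n} → 1 ≤ m → m ≤ n → m ∣ n !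
∣n! {suc m} _ m≤n = ∣-trans (m∣m*n (m !)) (m≤n⇒m!∣n! m≤n)

-- Euclid: every prime factor of B ! + 1 exceeds B.
∃-prime> : ∀ B → ∃ λ p → Prime p × B < p
∃-prime> B with factorise (B ! + 1) {{>-nonZero (m≤n+m 1 (B !))}}
... | record { factors = [] ; isFactorisation = B!+1≡1 } =
  contradiction (+-cancelʳ-≡ 1 (B !) 0 B!+1≡1) (≢-nonZero⁻¹ (B !) {{B !≢0}})
... | record { factors = q ∷ qs ; isFactorisation = B!+1≡q*qs ; factorsPrime = q-prime ∷ _ }
  with B <? q
...   | yes B<q = q , q-prime , B<q
...   | no B≮q = contradiction q-prime (subst (λ m → ¬ Prime m) (sym q≡1) ¬prime[1])
  where
  q∣B!+1 : q ∣ B ! + 1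
  q∣B!+1 = subst (q ∣_) (sym B!+1≡q*qs) (m∣m*n (product qs))
  q≡1 : q ≡ 1
  q≡1 = ∣1⇒≡1 (∣m+n∣m⇒∣n q∣B!+1 (∣n! (>-nonZero⁻¹ q {{prime⇒nonZero q-prime}}) (≮⇒≥ B≮q)))

length-concatMap : ∀ {A B : Set} {d} (f : A → List B) → (∀ x → length (f x) ≤ d) →
                   ∀ xs → length (concatMap f xs) ≤ length xs * d
length-concatMap f f≤d []       = z≤n
length-concatMap f f≤d (x ∷ xs) =
  ≤-trans (≤-reflexive (length-++ (f x))) (+-mono-≤ (f≤d x) (length-concatMap f f≤d xs))

All-concatMap⁻ : ∀ {A B : Set} {P : B → Set} (f : A → List B) {xs x} →
                 All P (concatMap f xs) → x ∈ xs → All P (f x)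
All-concatMap⁻ f all x∈xs = All.lookup (All.map⁻ (All.concat⁻ all)) x∈xs

elements : ∀ {n} → Subset n → List (Fin n)
elements []            = []
elements (true  ∷ s)   = zero ∷ map suc (elements s)
elements (false ∷ s)   = map suc (elements s)

length-elements : ∀ {n} (s : Subset n) → length (elements s) ≡ ∣ s ∣
length-elements []          = refl
length-elements (true  ∷ s) = cong suc (trans (length-map suc (elements s)) (length-elements s))
length-elements (false ∷ s) = trans (length-map suc (elements s)) (length-elements s)

∈-elements : ∀ {n} {x : Fin n} {s} → x ∈ₛ s → x ∈ elements s
∈-elements {x = zero}  {true  ∷ s} Vec.here        = here refl
∈-elements {x = suc x} {true  ∷ s} (Vec.there x∈s) = there (∈-map⁺ suc (∈-elements x∈s))
∈-elements {x = suc x} {false ∷ s} (Vec.there x∈s) = ∈-map⁺ suc (∈-elements x∈s)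

module ModularArithmetic {p : ℕ} (p-prime : Prime p) where

  instance
    p≢0 : NonZero p
    p≢0 = prime⇒nonZero p-prime

  infix 4 _≈_ _≈?_

  record _≈_ (a b : ℕ) : Set where
    constructor mk≈
    field %-≡ : a % p ≡ b % p

  ≈-isEquivalence : IsEquivalence _≈_
  ≈-isEquivalence = record
    { refl  = mk≈ refl
    ; sym   = λ (mk≈ e) → mk≈ (sym e)
    ; trans = λ (mk≈ e) (mk≈ f) → mk≈ (trans e f)
    }

  ≈-setoid : Setoid 0ℓ 0ℓ
  ≈-setoid = record { isEquivalence = ≈-isEquivalence }

  open IsEquivalence ≈-isEquivalence public
    using () renaming (refl to ≈-refl; sym to ≈-sym; trans to ≈-trans; reflexive to ≡⇒≈)

  module ≈-Reasoning = Relation.Binary.Reasoning.Setoid ≈-setoid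

  _≈?_ : Decidable _≈_
  a ≈? b = map′ mk≈ _≈_.%-≡ (a % p ≟ b % p)

  %-≈ : ∀ a → a % p ≈ a
  %-≈ a = mk≈ (m%n%n≡m%n a p)

  <p-≈⇒≡ : ∀ {a b} → a < p → b < p → a ≈ b → a ≡ b
  <p-≈⇒≡ a<p b<p (mk≈ e) = trans (sym (m<n⇒m%n≡m a<p)) (trans e (m<n⇒m%n≡m b<p))

  0%p≡0 : 0 % p ≡ 0
  0%p≡0 = m<n⇒m%n≡m (>-nonZero⁻¹ p)

  1≉0 : ¬ 1 ≈ 0
  1≉0 e = contradiction (<p-≈⇒≡ 1<p (<-trans z<s 1<p) e) λ ()
    where
    1<p : 1 < p
    1<p = nonTrivial⇒n>1 p {{prime⇒nonTrivial p-prime}}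

  +-cong : ∀ {a a′ b b′} → a ≈ a′ → b ≈ b′ → a + b ≈ a′ + b′
  +-cong {a} {a′} {b} {b′} (mk≈ e) (mk≈ f) = mk≈ (begin
    (a + b) % p             ≡⟨ %-distribˡ-+ a b p ⟩
    (a % p + b % p) % p     ≡⟨ cong₂ (λ x y → (x + y) % p) e f ⟩
    (a′ % p + b′ % p) % p   ≡⟨ %-distribˡ-+ a′ b′ p ⟨
    (a′ + b′) % p           ∎)
    where open ≡-Reasoning

  *-cong : ∀ {a a′ b b′} → a ≈ a′ → b ≈ b′ → a * b ≈ a′ * b′
  *-cong {a} {a′} {b} {b′} (mk≈ e) (mk≈ f) = mk≈ (begin
    (a * b) % p               ≡⟨ %-distribˡ-* a b p ⟩
    (a % p * (b % p)) % p     ≡⟨ cong₂ (λ x y → (x * y) % p) e f ⟩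
    (a′ % p * (b′ % p)) % p   ≡⟨ %-distribˡ-* a′ b′ p ⟨
    (a′ * b′) % p             ∎)
    where open ≡-Reasoning

  +-congˡ : ∀ a {b b′} → b ≈ b′ → a + b ≈ a + b′
  +-congˡ a = +-cong {a} ≈-refl

  *-congˡ : ∀ a {b b′} → b ≈ b′ → a * b ≈ a * b′
  *-congˡ a = *-cong {a} ≈-refl

  ^-cong : ∀ {x y} m → x ≈ y → x ^ m ≈ y ^ m
  ^-cong zero    e = ≈-refl
  ^-cong (suc m) e = *-cong e (^-cong m e)

  p*≈0 : ∀ x → p * x ≈ 0
  p*≈0 x = mk≈ (trans (cong (_% p) (*-comm p x)) (trans (m*n%n≡0 x p) (sym 0%p≡0)))

  -- Negation without subtraction: since p ≈ 0, (p - 1) * x behaves as -x.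
  neg : ℕ → ℕ
  neg x = pred p * x

  +-inverseʳ : ∀ x → x + neg x ≈ 0
  +-inverseʳ x = ≈-trans (≡⇒≈ (cong (_* x) (suc-pred p))) (p*≈0 x)

  +-cancelʳ : ∀ {a b} c → a + c ≈ b + c → a ≈ b
  +-cancelʳ {a} {b} c e = begin
    a                    ≡⟨ +-identityʳ a ⟨
    a + 0                ≈⟨ +-congˡ a (+-inverseʳ c) ⟨
    a + (c + neg c)      ≡⟨ +-assoc a c (neg c) ⟨
    a + c + neg c        ≈⟨ +-cong e ≈-refl ⟩
    b + c + neg c        ≡⟨ +-assoc b c (neg c) ⟩
    b + (c + neg c)      ≈⟨ +-congˡ b (+-inverseʳ c) ⟩
    b + 0                ≡⟨ +-identityʳ b ⟩
    b                    ∎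
    where open ≈-Reasoning

  ≈⇒-≈0 : ∀ {a b} → a ≈ b → a + neg b ≈ 0
  ≈⇒-≈0 {a} {b} e = ≈-trans (+-cong e ≈-refl) (+-inverseʳ b)

  -≈0⇒≈ : ∀ {a b} → a + neg b ≈ 0 → a ≈ b
  -≈0⇒≈ {a} {b} e = +-cancelʳ (neg b) (≈-trans e (≈-sym (+-inverseʳ b)))

  m*n≈0⇒m≈0⊎n≈0 : ∀ a b → a * b ≈ 0 → a ≈ 0 ⊎ b ≈ 0
  m*n≈0⇒m≈0⊎n≈0 a b (mk≈ e) with euclidsLemma a b p-prime (m%n≡0⇒n∣m (a * b) p (trans e 0%p≡0))
  ... | inj₁ p∣a = inj₁ (mk≈ (trans (n∣m⇒m%n≡0 a p p∣a) (sym 0%p≡0)))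
  ... | inj₂ p∣b = inj₂ (mk≈ (trans (n∣m⇒m%n≡0 b p p∣b) (sym 0%p≡0)))

  m*o≈n*o⇒m≈n⊎o≈0 : ∀ a b c → a * c ≈ b * c → a ≈ b ⊎ c ≈ 0
  m*o≈n*o⇒m≈n⊎o≈0 a b c e with m*n≈0⇒m≈0⊎n≈0 (a + neg b) c difference≈0
    where
    difference≈0 : (a + neg b) * c ≈ 0
    difference≈0 = begin
      (a + neg b) * c            ≡⟨ rearrange a b c (pred p) ⟩
      a * c + neg (b * c)        ≈⟨ ≈⇒-≈0 e ⟩
      0                          ∎
      where
      open ≈-Reasoning
      rearrange : ∀ a b c m → (a + m * b) * c ≡ a * c + m * (b * c)
      rearrange = solve-∀
  ... | inj₁ a-b≈0 = inj₁ (-≈0⇒≈ a-b≈0)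
  ... | inj₂ c≈0   = inj₂ c≈0

  ≉0⇒coprime : ∀ d → ¬ d ≈ 0 → Coprime d p
  ≉0⇒coprime d d≉0 (e∣d , e∣p) with prime⇒irreducible p-prime e∣p
  ... | inj₁ e≡1 = e≡1
  ... | inj₂ refl = contradiction (mk≈ (trans (n∣m⇒m%n≡0 d p e∣d) (sym 0%p≡0))) d≉0

  ∃-inverse : ∀ d → ¬ d ≈ 0 → ∃ λ e → d * e ≈ 1
  ∃-inverse d d≉0 with coprime-Bézout (≉0⇒coprime d d≉0)
  ... | Bézout.+- x y eq = x , (begin
    d * x      ≡⟨ *-comm d x ⟩
    x * d      ≡⟨ eq ⟨
    1 + y * p  ≈⟨ +-congˡ 1 (≈-trans (≡⇒≈ (*-comm y p)) (p*≈0 y)) ⟩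
    1          ∎)
    where open ≈-Reasoning
  ... | Bézout.-+ x y eq = neg x , -≈0⇒≈ (begin
    d * neg x + neg 1      ≡⟨ rearrange d x (pred p) ⟩
    pred p * (1 + x * d)   ≡⟨ cong (pred p *_) (trans eq (*-comm y p)) ⟩
    pred p * (p * y)       ≈⟨ *-congˡ (pred p) (p*≈0 y) ⟩
    pred p * 0             ≡⟨ *-zeroʳ (pred p) ⟩
    0                      ∎)
    where
    open ≈-Reasoning
    rearrange : ∀ d x m → d * (m * x) + m * 1 ≡ m * (1 + x * d)
    rearrange = solve-∀

  residue : ℕ → Fin p
  residue a = fromℕ< (m%n<n a p)

  toℕ-residue : ∀ a → toℕ (residue a) ≈ a
  toℕ-residue a = ≈-trans (≡⇒≈ (toℕ-fromℕ< (m%n<n a p))) (%-≈ a)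

  ∃-avoiding : ∀ rs → length rs < p → ∃ λ a → All (λ r → ¬ a ≈ r) rs
  ∃-avoiding rs short =
    let i , i∉ = ∃-∉ (map residue rs) (subst (_< p) (sym (length-map residue rs)) short)
    in toℕ i , All.tabulate λ r∈rs i≈r →
         i∉ (subst (_∈ map residue rs) (sym (i≡residue i≈r)) (∈-map⁺ residue r∈rs))
    where
    i≡residue : ∀ {i r} → toℕ i ≈ r → i ≡ residue r
    i≡residue {i} i≈r =
      toℕ-injective (<p-≈⇒≡ (toℕ<n i) (toℕ<n (residue _)) (≈-trans i≈r (≈-sym (toℕ-residue _))))

-- Polynomials are coefficient lists, constant term first.
eval : List ℕ → ℕ → ℕ
eval []       x = 0
eval (c ∷ cs) x = c + x * eval cs x

infixl 6 _⊕_

_⊕_ : List ℕ → List ℕ → List ℕ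
[]       ⊕ Q        = Q
(a ∷ P)  ⊕ []       = a ∷ P
(a ∷ P)  ⊕ (b ∷ Q)  = a + b ∷ P ⊕ Q

eval-⊕ : ∀ P Q x → eval (P ⊕ Q) x ≡ eval P x + eval Q x
eval-⊕ []      Q       x = refl
eval-⊕ (a ∷ P) []      x = sym (+-identityʳ _)
eval-⊕ (a ∷ P) (b ∷ Q) x = begin
  a + b + x * eval (P ⊕ Q) x          ≡⟨ cong (λ e → a + b + x * e) (eval-⊕ P Q x) ⟩
  a + b + x * (eval P x + eval Q x)   ≡⟨ rearrange a b x (eval P x) (eval Q x) ⟩
  a + x * eval P x + (b + x * eval Q x) ∎
  where
  open ≡-Reasoning
  rearrange : ∀ a b x u v → a + b + x * (u + v) ≡ a + x * u + (b + x * v)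
  rearrange = solve-∀

length-⊕ : ∀ P Q {n} → length P ≤ n → length Q ≤ n → length (P ⊕ Q) ≤ n
length-⊕ []      Q       _         Q≤n       = Q≤n
length-⊕ (a ∷ P) []      P≤n       _         = P≤n
length-⊕ (a ∷ P) (b ∷ Q) (s≤s P≤n) (s≤s Q≤n) = s≤s (length-⊕ P Q P≤n Q≤n)

scale : ℕ → List ℕ → List ℕ
scale c = map (c *_)

eval-scale : ∀ c P x → eval (scale c P) x ≡ c * eval P x
eval-scale c []      x = sym (*-zeroʳ c)
eval-scale c (a ∷ P) x = begin
  c * a + x * eval (scale c P) x   ≡⟨ cong (λ e → c * a + x * e) (eval-scale c P x) ⟩
  c * a + x * (c * eval P x)       ≡⟨ rearrange c a x (eval P x) ⟩
  c * (a + x * eval P x)           ∎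
  where
  open ≡-Reasoning
  rearrange : ∀ c a x u → c * a + x * (c * u) ≡ c * (a + x * u)
  rearrange = solve-∀

eval-∷ʳ : ∀ P ℓ x → eval (P ++ [ ℓ ]) x ≡ eval P x + x ^ length P * ℓ
eval-∷ʳ []      ℓ x = cong (ℓ +_) (*-zeroʳ x)
eval-∷ʳ (a ∷ P) ℓ x = begin
  a + x * eval (P ++ [ ℓ ]) x           ≡⟨ cong (λ e → a + x * e) (eval-∷ʳ P ℓ x) ⟩
  a + x * (eval P x + x ^ length P * ℓ) ≡⟨ rearrange a x (eval P x) (x ^ length P) ℓ ⟩
  a + x * eval P x + x * x ^ length P * ℓ ∎
  where
  open ≡-Reasoning
  rearrange : ∀ a x u w ℓ → a + x * (u + w * ℓ) ≡ a + x * u + x * w * ℓ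
  rearrange = solve-∀

divideBy : List ℕ → ℕ → List ℕ
divideBy []           r = []
divideBy (c ∷ [])     r = []
divideBy (c ∷ d ∷ ds) r = eval (d ∷ ds) r ∷ divideBy (d ∷ ds) r

length-divideBy : ∀ c cs r → length (divideBy (c ∷ cs) r) ≡ length cs
length-divideBy c []       r = refl
length-divideBy c (d ∷ ds) r = cong suc (length-divideBy d ds r)

-- P(x) - P(r) = (x - r) Q(x) for Q = divideBy P r, with both sides moved so that no subtraction occurs.
divideBy-identity : ∀ P r x →
  eval P x + r * eval (divideBy P r) x ≡ eval P r + x * eval (divideBy P r) x
divideBy-identity []           r x = trans (+-identityˡ _) (trans (*-zeroʳ r) (sym (*-zeroʳ x)))
divideBy-identity (c ∷ [])     r x = trans (cong₂ (λ a b → c + a + b) (*-zeroʳ x) (*-zeroʳ r))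
                                           (sym (cong₂ (λ a b → c + a + b) (*-zeroʳ r) (*-zeroʳ x)))
divideBy-identity (c ∷ d ∷ ds) r x = begin
  c + x * S x + r * (S r + x * Q x)   ≡⟨ rearrange c x r (S x) (S r) (Q x) ⟩
  c + r * S r + x * (S x + r * Q x)   ≡⟨ cong (λ e → c + r * S r + x * e) (divideBy-identity (d ∷ ds) r x) ⟩
  c + r * S r + x * (S r + x * Q x)   ∎
  where
  open ≡-Reasoning
  S = eval (d ∷ ds)
  Q = eval (divideBy (d ∷ ds) r)
  rearrange : ∀ c x r Sx Sr Qx → c + x * Sx + r * (Sr + x * Qx) ≡ c + r * Sr + x * (Sx + r * Qx)
  rearrange = solve-∀

module PolynomialsModulo {p : ℕ} (p-prime : Prime p) where

  open ModularArithmetic p-prime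

  IsZero : List ℕ → Set
  IsZero = All (_≈ 0)

  eval-cong : ∀ P {x y} → x ≈ y → eval P x ≈ eval P y
  eval-cong []      x≈y = ≈-refl
  eval-cong (c ∷ P) x≈y = +-congˡ c (*-cong x≈y (eval-cong P x≈y))

  root-divideBy : ∀ P {r a} → eval P r ≈ 0 → eval P a ≈ 0 →
                  a ≈ r ⊎ eval (divideBy P r) a ≈ 0
  root-divideBy P {r} {a} Pr≈0 Pa≈0 = m*o≈n*o⇒m≈n⊎o≈0 a r (Q a) (+-cancelʳ 0 (begin
    a * Q a + 0              ≡⟨ +-comm (a * Q a) 0 ⟩
    0 + a * Q a              ≈⟨ +-cong Pr≈0 ≈-refl ⟨
    eval P r + a * Q a       ≡⟨ divideBy-identity P r a ⟨
    eval P a + r * Q a       ≈⟨ +-cong Pa≈0 ≈-refl ⟩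
    r * Q a                  ≡⟨ +-identityʳ (r * Q a) ⟨
    r * Q a + 0              ∎))
    where
    open ≈-Reasoning
    Q = eval (divideBy P r)

  IsZero-divideBy : ∀ P {r} → eval P r ≈ 0 → IsZero (divideBy P r) → IsZero P
  IsZero-divideBy []           _     _ = []
  IsZero-divideBy (c ∷ [])     {r} c≈0 _ =
    ≈-trans (≡⇒≈ (sym (trans (cong (c +_) (*-zeroʳ r)) (+-identityʳ c)))) c≈0 ∷ []
  IsZero-divideBy (c ∷ d ∷ ds) {r} Pr≈0 (Sr≈0 ∷ zQ) = c≈0 ∷ IsZero-divideBy (d ∷ ds) Sr≈0 zQ
    where
    c≈0 : c ≈ 0
    c≈0 = begin
      c                          ≡⟨ +-identityʳ c ⟨
      c + 0                      ≡⟨ cong (c +_) (*-zeroʳ r) ⟨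
      c + r * 0                  ≈⟨ +-congˡ c (*-congˡ r Sr≈0) ⟨
      c + r * eval (d ∷ ds) r    ≈⟨ Pr≈0 ⟩
      0                          ∎
      where open ≈-Reasoning

  RootsCoveredBy : List ℕ → List ℕ → Set
  RootsCoveredBy rs P = ∀ {a} → eval P a ≈ 0 → Any (a ≈_) rs

  ∃-roots : ∀ P → ¬ IsZero P → ∃ λ rs → length rs < length P × RootsCoveredBy rs P
  ∃-roots P = bounded (length P) P ≤-refl
    where
    bounded : ∀ n P → length P ≤ n → ¬ IsZero P → ∃ λ rs → length rs < length P × RootsCoveredBy rs P
    bounded n       []       _         nz = contradiction [] nz
    bounded (suc n) (c ∷ cs) (s≤s len) nz with Fin.any? (λ i → eval (c ∷ cs) (toℕ i) ≈? 0)
    ... | no noRootBelowP = [] , s≤s z≤n , λ {a} Pa≈0 →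
      contradiction (residue a , ≈-trans (eval-cong (c ∷ cs) (toℕ-residue a)) Pa≈0) noRootBelowP
    ... | yes (i , Pr≈0) =
      let rs , rs<Q , covered = bounded n Q (subst (_≤ n) (sym lenQ) len)
                                  (λ zQ → nz (IsZero-divideBy (c ∷ cs) Pr≈0 zQ))
      in toℕ i ∷ rs , s≤s (subst (length rs <_) lenQ rs<Q) ,
         λ Pa≈0 → [ here , there ∘ covered ]′ (root-divideBy (c ∷ cs) Pr≈0 Pa≈0)
      where
      Q = divideBy (c ∷ cs) (toℕ i)
      lenQ : length Q ≡ length cs
      lenQ = length-divideBy c cs (toℕ i)

  mulLinear : ℕ → List ℕ → List ℕ
  mulLinear r N = (0 ∷ N) ⊕ scale (neg r) N

  eval-mulLinear : ∀ r N y → eval (mulLinear r N) y ≡ (y + neg r) * eval N y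
  eval-mulLinear r N y = begin
    eval ((0 ∷ N) ⊕ scale (neg r) N) y         ≡⟨ eval-⊕ (0 ∷ N) (scale (neg r) N) y ⟩
    y * eval N y + eval (scale (neg r) N) y    ≡⟨ cong (y * eval N y +_) (eval-scale (neg r) N y) ⟩
    y * eval N y + neg r * eval N y            ≡⟨ *-distribʳ-+ (eval N y) y (neg r) ⟨
    (y + neg r) * eval N y                     ∎
    where open ≡-Reasoning

  length-mulLinear : ∀ r N {n} → length N ≤ n → length (mulLinear r N) ≤ suc n
  length-mulLinear r N N≤n = length-⊕ (0 ∷ N) (scale (neg r) N) (s≤s N≤n)
    (m≤n⇒m≤1+n (subst (_≤ _) (sym (length-map (neg r *_) N)) N≤n))

  vanishing : List ℕ → List ℕ
  vanishing []       = [ 1 ]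
  vanishing (x ∷ xs) = mulLinear x (vanishing xs)

  length-vanishing : ∀ xs → length (vanishing xs) ≤ suc (length xs)
  length-vanishing []       = ≤-refl
  length-vanishing (x ∷ xs) = length-mulLinear x (vanishing xs) (length-vanishing xs)

  vanishing-root : ∀ {x} xs → x ∈ xs → eval (vanishing xs) x ≈ 0
  vanishing-root {x} (y ∷ xs) x∈ = begin
    eval (mulLinear y (vanishing xs)) x   ≡⟨ eval-mulLinear y (vanishing xs) x ⟩
    (x + neg y) * eval (vanishing xs) x   ≈⟨ factor≈0 x∈ ⟩
    0                                     ∎
    where
    open ≈-Reasoning
    factor≈0 : x ∈ y ∷ xs → (x + neg y) * eval (vanishing xs) x ≈ 0
    factor≈0 (here refl) = *-cong (+-inverseʳ x) ≈-refl
    factor≈0 (there x∈xs) = ≈-trans (*-congˡ (x + neg y) (vanishing-root xs x∈xs))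
                                    (≡⇒≈ (*-zeroʳ (x + neg y)))

  vanishing-root⁻ : ∀ {y} xs → eval (vanishing xs) y ≈ 0 → Any (y ≈_) xs
  vanishing-root⁻ {y} []       e = contradiction (≈-trans (≡⇒≈ (sym (cong (1 +_) (*-zeroʳ y)))) e) 1≉0
  vanishing-root⁻ {y} (x ∷ xs) e
    with m*n≈0⇒m≈0⊎n≈0 (y + neg x) _ (≈-trans (≡⇒≈ (sym (eval-mulLinear x (vanishing xs) y))) e)
  ... | inj₁ y-x≈0 = here (-≈0⇒≈ y-x≈0)
  ... | inj₂ N≈0   = there (vanishing-root⁻ xs N≈0)

  Consistent : List (ℕ × ℕ) → Set
  Consistent ps = ∀ {x v y w} → (x , v) ∈ ps → (y , w) ∈ ps → x ≈ y → v ≈ w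

  Interpolates : List ℕ → List (ℕ × ℕ) → Set
  Interpolates P = All λ (x , v) → eval P x ≈ v

  -- Newton's scheme: correct P by a multiple of the polynomial vanishing on the old nodes.
  interpolant-∷ : ∀ x v ps P → Consistent ((x , v) ∷ ps) → length P ≤ length ps → Interpolates P ps →
                  ∃ λ P′ → length P′ ≤ suc (length ps) × Interpolates P′ ((x , v) ∷ ps)
  interpolant-∷ x v ps P consistent P≤ fits with eval N x ≈? 0
    where N = vanishing (map proj₁ ps)
  ... | yes Nx≈0 =
    let (y , w) , q∈ps , x≈y = find (Any.map⁻ (vanishing-root⁻ (map proj₁ ps) Nx≈0))
    in P , m≤n⇒m≤1+n P≤ , ≈-trans (eval-cong P x≈y)
                            (≈-trans (All.lookup fits q∈ps) (≈-sym (consistent (here refl) (there q∈ps) x≈y)))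
                          ∷ fits
  ... | no Nx≉0 = P ⊕ scale λ′ N , length-P′ , fit-x ∷ All.tabulate (λ {(y , w)} → fit-old {y} {w})
    where
    N  = vanishing (map proj₁ ps)
    e  = proj₁ (∃-inverse (eval N x) Nx≉0)
    Nx*e≈1 = proj₂ (∃-inverse (eval N x) Nx≉0)
    λ′ = (v + neg (eval P x)) * e

    eval-P′ : ∀ y → eval (P ⊕ scale λ′ N) y ≡ eval P y + λ′ * eval N y
    eval-P′ y = trans (eval-⊕ P (scale λ′ N) y) (cong (eval P y +_) (eval-scale λ′ N y))

    length-P′ : length (P ⊕ scale λ′ N) ≤ suc (length ps)
    length-P′ = length-⊕ P (scale λ′ N) (m≤n⇒m≤1+n P≤)
      (subst (_≤ suc (length ps)) (sym (length-map (λ′ *_) N))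
        (subst (λ l → length N ≤ suc l) (length-map proj₁ ps) (length-vanishing (map proj₁ ps))))

    fit-x : eval (P ⊕ scale λ′ N) x ≈ v
    fit-x = begin
      eval (P ⊕ scale λ′ N) x                          ≡⟨ eval-P′ x ⟩
      eval P x + (v + neg (eval P x)) * e * eval N x   ≡⟨ rearrange (eval P x) (v + neg (eval P x)) e (eval N x) ⟩
      eval P x + (v + neg (eval P x)) * (eval N x * e) ≈⟨ +-congˡ (eval P x) (*-congˡ (v + neg (eval P x)) Nx*e≈1) ⟩
      eval P x + (v + neg (eval P x)) * 1              ≡⟨ rearrange′ (eval P x) v (neg (eval P x)) ⟩
      v + (eval P x + neg (eval P x))                  ≈⟨ +-congˡ v (+-inverseʳ (eval P x)) ⟩
      v + 0                                            ≡⟨ +-identityʳ v ⟩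
      v                                                ∎
      where
      open ≈-Reasoning
      rearrange : ∀ a b e n → a + b * e * n ≡ a + b * (n * e)
      rearrange = solve-∀
      rearrange′ : ∀ a v b → a + (v + b) * 1 ≡ v + (a + b)
      rearrange′ = solve-∀

    fit-old : ∀ {y w} → (y , w) ∈ ps → eval (P ⊕ scale λ′ N) y ≈ w
    fit-old {y} {w} q∈ps = begin
      eval (P ⊕ scale λ′ N) y       ≡⟨ eval-P′ y ⟩
      eval P y + λ′ * eval N y      ≈⟨ +-congˡ (eval P y) (*-congˡ λ′ Ny≈0) ⟩
      eval P y + λ′ * 0             ≡⟨ cong (eval P y +_) (*-zeroʳ λ′) ⟩
      eval P y + 0                  ≡⟨ +-identityʳ (eval P y) ⟩
      eval P y                      ≈⟨ All.lookup fits q∈ps ⟩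
      w                             ∎
      where
      open ≈-Reasoning
      Ny≈0 = vanishing-root (map proj₁ ps) (∈-map⁺ proj₁ q∈ps)

  ∃-interpolant : ∀ ps → Consistent ps → ∃ λ P → length P ≤ length ps × Interpolates P ps
  ∃-interpolant []             _          = [] , z≤n , []
  ∃-interpolant ((x , v) ∷ ps) consistent =
    let P , P≤ , fits = ∃-interpolant ps (λ i j → consistent (there i) (there j))
    in interpolant-∷ x v ps P consistent P≤ fits

  infixl 6 _⊖_

  _⊖_ : List ℕ → List ℕ → List ℕ
  P ⊖ Q = P ⊕ scale (pred p) Q

  eval-⊖ : ∀ P Q x → eval (P ⊖ Q) x ≡ eval P x + neg (eval Q x)
  eval-⊖ P Q x = trans (eval-⊕ P (scale (pred p) Q) x) (cong (eval P x +_) (eval-scale (pred p) Q x))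

  length-⊖ : ∀ P Q {n} → length P ≤ n → length Q ≤ n → length (P ⊖ Q) ≤ n
  length-⊖ P Q P≤n Q≤n = length-⊕ P (scale (pred p) Q) P≤n (subst (_≤ _) (sym (length-map _ Q)) Q≤n)

  IsZero-⊖⇒≡ : ∀ {P Q} → length P ≡ length Q → All (_< p) P → All (_< p) Q → IsZero (P ⊖ Q) → P ≡ Q
  IsZero-⊖⇒≡ {[]}    {[]}    _   _          _          _            = refl
  IsZero-⊖⇒≡ {a ∷ P} {b ∷ Q} len (a<p ∷ P<p) (b<p ∷ Q<p) (a-b≈0 ∷ z) =
    cong₂ _∷_ (<p-≈⇒≡ a<p b<p (-≈0⇒≈ a-b≈0)) (IsZero-⊖⇒≡ (suc-injective len) P<p Q<p z)

  IsZero-⊖-constant : ∀ c P x → IsZero ((c ∷ P) ⊖ [ x ]) → IsZero P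
  IsZero-⊖-constant c []      x _       = []
  IsZero-⊖-constant c (d ∷ P) x (_ ∷ z) = z

-- Fewer than k² differences s - t and k (k + 1) shifts t - x, each with at most D = k + k roots.
badPointBound : ℕ → ℕ
badPointBound k = k * (k * (k + k)) + k * (suc k * (k + k))

module PartiteGraph (k : ℕ) {p : ℕ} (p-prime : Prime p) where

  open ModularArithmetic p-prime
  open PolynomialsModulo p-prime

  D : ℕ
  D = k + k

  digits : ∀ m → Fin (p ^ m) → List ℕ
  digits zero    _ = []
  digits (suc m) i = toℕ (quotient {p} (p ^ m) i) ∷ digits m (remainder {p} (p ^ m) i)

  fromDigits : ∀ m → List ℕ → Fin (p ^ m)
  fromDigits zero    _       = zero
  fromDigits (suc m) []      = combine (residue 0) (fromDigits m [])
  fromDigits (suc m) (a ∷ P) = combine (residue a) (fromDigits m P)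

  length-digits : ∀ m i → length (digits m i) ≡ m
  length-digits zero    i = refl
  length-digits (suc m) i = cong suc (length-digits m _)

  digits<p : ∀ m i → All (_< p) (digits m i)
  digits<p zero    i = []
  digits<p (suc m) i = toℕ<n _ ∷ digits<p m _

  digits-injective : ∀ m {i j} → digits m i ≡ digits m j → i ≡ j
  digits-injective zero    {zero} {zero} _ = refl
  digits-injective (suc m) {i}    {j}    eq = begin
    i
      ≡⟨ combine-remQuot {p} (p ^ m) i ⟨
    combine (quotient {p} (p ^ m) i) (remainder {p} (p ^ m) i)
      ≡⟨ cong₂ combine (toℕ-injective (proj₁ (∷-injective eq))) (digits-injective m (proj₂ (∷-injective eq))) ⟩
    combine (quotient {p} (p ^ m) j) (remainder {p} (p ^ m) j)
      ≡⟨ combine-remQuot {p} (p ^ m) j ⟩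
    j
      ∎
    where open ≡-Reasoning

  digits-combine : ∀ m d r → digits (suc m) (combine d r) ≡ toℕ d ∷ digits m r
  digits-combine m d r =
    cong (λ ((q , r′) : Fin p × Fin (p ^ m)) → toℕ q ∷ digits m r′) (remQuot-combine {p} {p ^ m} d r)

  eval-fromDigits : ∀ m P x → length P ≤ m → eval (digits m (fromDigits m P)) x ≈ eval P x
  eval-fromDigits zero    []      x _         = ≈-refl
  eval-fromDigits (suc m) []      x _         = begin
    eval (digits (suc m) (combine (residue 0) (fromDigits m []))) x
      ≡⟨ cong (λ ds → eval ds x) (digits-combine m (residue 0) _) ⟩
    toℕ (residue 0) + x * eval (digits m (fromDigits m [])) x
      ≈⟨ +-cong (toℕ-residue 0) (*-congˡ x (eval-fromDigits m [] x z≤n)) ⟩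
    0 + x * 0
      ≡⟨ *-zeroʳ x ⟩
    0
      ∎
    where open ≈-Reasoning
  eval-fromDigits (suc m) (a ∷ P) x (s≤s P≤m) = begin
    eval (digits (suc m) (combine (residue a) (fromDigits m P))) x
      ≡⟨ cong (λ ds → eval ds x) (digits-combine m (residue a) _) ⟩
    toℕ (residue a) + x * eval (digits m (fromDigits m P)) x
      ≈⟨ +-cong (toℕ-residue a) (*-congˡ x (eval-fromDigits m P x P≤m)) ⟩
    a + x * eval P x
      ∎
    where open ≈-Reasoning

  Vertex : Set
  Vertex = Fin (k * p ^ D)

  class : Vertex → Fin k
  class = quotient (p ^ D)

  -- The index of a vertex encodes its class and, in base p, the lower coefficients of its polynomial.
  lowerCoefficients : Vertex → List ℕ
  lowerCoefficients v = digits D (remainder {k} (p ^ D) v)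

  poly : Vertex → List ℕ
  poly v = lowerCoefficients v ++ [ suc (toℕ (class v)) ]

  length-poly : ∀ v → length (poly v) ≡ suc D
  length-poly v = trans (length-++ (digits D _)) (trans (cong (_+ 1) (length-digits D _)) (+-comm D 1))

  eval-poly : ∀ v x → eval (poly v) x ≡ eval (lowerCoefficients v) x + x ^ D * suc (toℕ (class v))
  eval-poly v x = trans (eval-∷ʳ (lowerCoefficients v) _ x)
    (cong (λ l → eval (lowerCoefficients v) x + x ^ l * suc (toℕ (class v))) (length-digits D _))

  poly-injective : ∀ {u v} → poly u ≡ poly v → u ≡ v
  poly-injective {u} {v} eq = begin
    u                                              ≡⟨ combine-remQuot {k} (p ^ D) u ⟨
    combine (class u) (remainder {k} (p ^ D) u)    ≡⟨ cong₂ combine (toℕ-injective (suc-injective leading≡))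
                                                                    (digits-injective D digits≡) ⟩
    combine (class v) (remainder {k} (p ^ D) v)    ≡⟨ combine-remQuot {k} (p ^ D) v ⟩
    v                                              ∎
    where
    open ≡-Reasoning
    digits≡ = proj₁ (∷ʳ-injective (lowerCoefficients u) (lowerCoefficients v) eq)
    leading≡ = proj₂ (∷ʳ-injective (lowerCoefficients u) (lowerCoefficients v) eq)

  vertexWith : Fin k → List ℕ → Vertex
  vertexWith c P = combine c (fromDigits D P)

  class-vertexWith : ∀ c P → class (vertexWith c P) ≡ c
  class-vertexWith c P = cong proj₁ (remQuot-combine {k} {p ^ D} c (fromDigits D P))

  lowerCoefficients-vertexWith : ∀ c P → lowerCoefficients (vertexWith c P) ≡ digits D (fromDigits D P)
  lowerCoefficients-vertexWith c P = cong (digits D ∘ proj₂) (remQuot-combine {k} {p ^ D} c (fromDigits D P))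

  eval-vertexWith : ∀ c P x → length P ≤ D →
    eval (poly (vertexWith c P)) x ≈ eval P x + x ^ D * suc (toℕ c)
  eval-vertexWith c P x P≤D = begin
    eval (poly z) x                                             ≡⟨ eval-poly z x ⟩
    eval (lowerCoefficients z) x + x ^ D * suc (toℕ (class z))  ≡⟨ cong₂ (λ cs c → eval cs x + x ^ D * suc (toℕ c))
                                                                         (lowerCoefficients-vertexWith c P) (class-vertexWith c P) ⟩
    eval (digits D (fromDigits D P)) x + x ^ D * suc (toℕ c)    ≈⟨ +-cong (eval-fromDigits D P x P≤D) ≈-refl ⟩
    eval P x + x ^ D * suc (toℕ c)                              ∎
    where
    open ≈-Reasoning
    z = vertexWith c P

  ∃-vertex-interpolating : ∀ c ps → Consistent ps → length ps ≤ D →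
    ∃ λ z → class z ≡ c × Interpolates (poly z) ps
  ∃-vertex-interpolating c ps consistent ps≤D =
    vertexWith c P , class-vertexWith c P , All.map (λ {(x , v)} → fit {x} {v}) (All.map⁻ fits)
    where
    lead : ℕ → ℕ
    lead x = x ^ D * suc (toℕ c)

    shift : ℕ × ℕ → ℕ × ℕ
    shift (x , v) = x , v + neg (lead x)

    consistent′ : Consistent (map shift ps)
    consistent′ q∈ q′∈ x≈y with ∈-map⁻ shift q∈ | ∈-map⁻ shift q′∈
    ... | (x , v) , xv∈ , refl | (y , w) , yw∈ , refl =
      +-cong (consistent xv∈ yw∈ x≈y) (*-congˡ (pred p) (*-cong (^-cong D x≈y) ≈-refl))

    interpolant = ∃-interpolant (map shift ps) consistent′
    P = proj₁ interpolant
    fits = proj₂ (proj₂ interpolant)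

    P≤D : length P ≤ D
    P≤D = ≤-trans (proj₁ (proj₂ interpolant)) (subst (_≤ D) (sym (length-map shift ps)) ps≤D)

    fit : ∀ {x v} → eval P x ≈ v + neg (lead x) → eval (poly (vertexWith c P)) x ≈ v
    fit {x} {v} Px≈ = begin
      eval (poly (vertexWith c P)) x   ≈⟨ eval-vertexWith c P x P≤D ⟩
      eval P x + lead x                ≈⟨ +-cong Px≈ ≈-refl ⟩
      v + neg (lead x) + lead x        ≡⟨ +-assoc v _ _ ⟩
      v + (neg (lead x) + lead x)      ≡⟨ cong (v +_) (+-comm (neg (lead x)) _) ⟩
      v + (lead x + neg (lead x))      ≈⟨ +-congˡ v (+-inverseʳ (lead x)) ⟩
      v + 0                            ≡⟨ +-identityʳ v ⟩
      v                                ∎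
      where open ≈-Reasoning

  bit : ℕ → Bool
  bit x = does (x ≈? 0)

  name : Vertex → ℕ
  name v = eval (poly v) 0

  view : Vertex → Vertex → Bool
  view u v = bit (eval (poly u) (eval (poly v) (name u)))

  adjacent : Vertex → Vertex → Bool
  adjacent u v = if does (class u Fin.≟ class v) then false else view u v xor view v u

  adjacent-sameClass : ∀ {u v} → class u ≡ class v → adjacent u v ≡ false
  adjacent-sameClass {u} {v} same with class u Fin.≟ class v
  ... | yes _ = refl
  ... | no different = contradiction same different

  adjacent-otherClass : ∀ {u v} → class u ≢ class v → adjacent u v ≡ view u v xor view v u
  adjacent-otherClass {u} {v} different with class u Fin.≟ class v
  ... | yes same = contradiction same different
  ... | no _ = refl

  adjacent-sym : ∀ u v → adjacent u v ≡ adjacent v u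
  adjacent-sym u v with class u Fin.≟ class v
  ... | yes same      = sym (adjacent-sameClass (sym same))
  ... | no different  = trans (xor-comm (view u v) (view v u)) (sym (adjacent-otherClass (different ∘ sym)))

  H : Graph
  H = record
    { n        = k * p ^ D
    ; adj      = adjacent
    ; sym      = adjacent-sym
    ; loopless = λ v → adjacent-sameClass refl
    }

  H-colourable : Colourable k H
  H-colourable = class , λ u v uv same → contradiction (trans (sym (adjacent-sameClass same)) uv) λ ()

  module Extension (k<p : k < p) (few-bad-points : badPointBound k < p) where

    poly<p : ∀ v → All (_< p) (poly v)
    poly<p v = All.++⁺ (digits<p D _) (≤-<-trans (toℕ<n (class v)) k<p ∷ [])

    poly-⊖-nonzero : ∀ {s t} → s ≢ t → ¬ IsZero (poly s ⊖ poly t)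
    poly-⊖-nonzero {s} {t} s≢t isZero = s≢t (poly-injective
      (IsZero-⊖⇒≡ (trans (length-poly s) (sym (length-poly t))) (poly<p s) (poly<p t) isZero))

    poly-⊖-constant-nonzero : ∀ t x → ¬ IsZero (poly t ⊖ [ x ])
    poly-⊖-constant-nonzero t x = nonzero (lowerCoefficients t) (subst (1 ≤_) (sym (length-digits D _)) 1≤D)
      where
      ℓ = suc (toℕ (class t))
      1≤D : 1 ≤ D
      1≤D = ≤-trans (≤-trans (s≤s z≤n) (toℕ<n (class t))) (m≤m+n k k)
      ℓ≉0 : ¬ ℓ ≈ 0
      ℓ≉0 ℓ≈0 with <p-≈⇒≡ (≤-<-trans (toℕ<n (class t)) k<p) (≤-<-trans z≤n k<p) ℓ≈0
      ... | ()
      nonzero : ∀ ds → 1 ≤ length ds → ¬ IsZero ((ds ++ [ ℓ ]) ⊖ [ x ])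
      nonzero (d ∷ ds) _ isZero = ℓ≉0 (All.head (All.++⁻ʳ ds (IsZero-⊖-constant d (ds ++ [ ℓ ]) x isZero)))

    length-poly-⊖ : ∀ t Q → length Q ≤ suc D → length (poly t ⊖ Q) ≤ suc D
    length-poly-⊖ t Q Q≤ = length-⊖ (poly t) Q (≤-reflexive (length-poly t)) Q≤

    pairRoots : Vertex → Vertex → List ℕ
    pairRoots s t with s Fin.≟ t
    ... | yes _   = []
    ... | no s≢t  = proj₁ (∃-roots (poly s ⊖ poly t) (poly-⊖-nonzero s≢t))

    length-pairRoots : ∀ s t → length (pairRoots s t) ≤ D
    length-pairRoots s t with s Fin.≟ t
    ... | yes _  = z≤n
    ... | no s≢t = ≤-pred (≤-trans (proj₁ (proj₂ (∃-roots _ (poly-⊖-nonzero s≢t))))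
                                   (length-poly-⊖ s (poly t) (≤-reflexive (length-poly t))))

    pairRoots-covers : ∀ {s t a} → s ≢ t → eval (poly s) a ≈ eval (poly t) a → Any (a ≈_) (pairRoots s t)
    pairRoots-covers {s} {t} {a} s≢t same with s Fin.≟ t
    ... | yes s≡t = contradiction s≡t s≢t
    ... | no s≢t′ = proj₂ (proj₂ (∃-roots _ (poly-⊖-nonzero s≢t′)))
                      (≈-trans (≡⇒≈ (eval-⊖ (poly s) (poly t) a)) (≈⇒-≈0 same))

    anchorRoots : Vertex → ℕ → List ℕ
    anchorRoots t x = proj₁ (∃-roots (poly t ⊖ [ x ]) (poly-⊖-constant-nonzero t x))

    length-anchorRoots : ∀ t x → length (anchorRoots t x) ≤ D
    length-anchorRoots t x = ≤-pred (≤-trans (proj₁ (proj₂ (∃-roots _ (poly-⊖-constant-nonzero t x))))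
                                             (length-poly-⊖ t [ x ] (s≤s z≤n)))

    anchorRoots-covers : ∀ {t x a} → eval (poly t) a ≈ x → Any (a ≈_) (anchorRoots t x)
    anchorRoots-covers {t} {x} {a} βt≈x = proj₂ (proj₂ (∃-roots _ (poly-⊖-constant-nonzero t x)))
      (≈-trans (≡⇒≈ (eval-⊖ (poly t) [ x ] a))
               (≈⇒-≈0 (≈-trans βt≈x (≡⇒≈ (sym (trans (cong (x +_) (*-zeroʳ a)) (+-identityʳ x)))))))

    anchors : List Vertex → List ℕ
    anchors L = 0 ∷ map name L

    pairPoints anchorPoints : List Vertex → Vertex → List ℕ
    pairPoints   L s = concatMap (pairRoots s) L
    anchorPoints L t = concatMap (anchorRoots t) (anchors L)

    badPoints : List Vertex → List ℕ
    badPoints L = concatMap (pairPoints L) L ++ concatMap (anchorPoints L) L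

    length-badPoints : ∀ L → length L < k → length (badPoints L) < p
    length-badPoints L short = ≤-<-trans (begin
      length (badPoints L)                       ≡⟨ length-++ (concatMap (pairPoints L) L) ⟩
      length (concatMap (pairPoints L) L)
        + length (concatMap (anchorPoints L) L)  ≤⟨ +-mono-≤ (length-concatMap _ pairs≤ L) (length-concatMap _ anchors≤ L) ⟩
      l * (l * D) + l * (suc l * D)              ≤⟨ +-mono-≤ (*-mono-≤ l≤k (*-monoˡ-≤ D l≤k))
                                                             (*-mono-≤ l≤k (*-monoˡ-≤ D (s≤s l≤k))) ⟩
      badPointBound k                            ∎) few-bad-points
      where
      open ≤-Reasoning
      l = length L
      l≤k = <⇒≤ short
      pairs≤ : ∀ s → length (pairPoints L s) ≤ l * D
      pairs≤ s = length-concatMap (pairRoots s) (length-pairRoots s) L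
      anchors≤ : ∀ t → length (anchorPoints L t) ≤ suc l * D
      anchors≤ t = subst (λ m → length (anchorPoints L t) ≤ suc m * D) (length-map name L)
                         (length-concatMap (anchorRoots t) (length-anchorRoots t) (anchors L))

    record Separating (L : List Vertex) (a : ℕ) : Set where
      field
        injective      : ∀ {s t} → s ∈ L → t ∈ L → eval (poly s) a ≈ eval (poly t) a → s ≡ t
        avoids-anchors : ∀ {t x} → t ∈ L → x ∈ anchors L → ¬ eval (poly t) a ≈ x

    ∃-separating : ∀ L → length L < k → ∃ (Separating L)
    ∃-separating L short = a , record { injective = injective ; avoids-anchors = avoids-anchors }
      where
      avoiding = ∃-avoiding (badPoints L) (length-badPoints L short)
      a = proj₁ avoiding
      avoids = All.++⁻ (concatMap (pairPoints L) L) (proj₂ avoiding)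

      injective : ∀ {s t} → s ∈ L → t ∈ L → eval (poly s) a ≈ eval (poly t) a → s ≡ t
      injective {s} {t} s∈L t∈L same with s Fin.≟ t
      ... | yes s≡t = s≡t
      ... | no s≢t  = contradiction (pairRoots-covers s≢t same)
        (All¬⇒¬Any (All-concatMap⁻ (pairRoots s) (All-concatMap⁻ _ (proj₁ avoids) s∈L) t∈L))

      avoids-anchors : ∀ {t x} → t ∈ L → x ∈ anchors L → ¬ eval (poly t) a ≈ x
      avoids-anchors {t} t∈L x∈anchors βt≈x = All¬⇒¬Any
        (All-concatMap⁻ (anchorRoots t) (All-concatMap⁻ _ (proj₂ avoids) t∈L) x∈anchors)
        (anchorRoots-covers βt≈x)

    labelValue : Bool → ℕ
    labelValue true  = 0
    labelValue false = 1

    bit-labelValue : ∀ {x} b → x ≈ labelValue b → bit x ≡ b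
    bit-labelValue {x} true  x≈0 = dec-true (x ≈? 0) x≈0
    bit-labelValue {x} false x≈1 = dec-false (x ≈? 0) λ x≈0 → 1≉0 (≈-trans (≈-sym x≈1) x≈0)

    witnessData : List Vertex → ℕ → (Vertex → Bool) → List (ℕ × ℕ)
    witnessData L a ε = map (_, a) (anchors L) ++ map (λ t → eval (poly t) a , labelValue (ε t)) L

    length-witnessData : ∀ L a ε → length L < k → length (witnessData L a ε) ≤ D
    length-witnessData L a ε short = begin
      length (witnessData L a ε)                          ≡⟨ length-++ (map (_, a) (anchors L)) ⟩
      length (map (_, a) (anchors L)) + length (map _ L)  ≡⟨ cong₂ _+_ (length-map _ (anchors L)) (length-map _ L) ⟩
      suc (length (map name L)) + length L                ≡⟨ cong (λ l → suc l + length L) (length-map name L) ⟩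
      suc (length L) + length L                           ≤⟨ +-mono-≤ short (<⇒≤ short) ⟩
      D                                                   ∎
      where open ≤-Reasoning

    witnessData-consistent : ∀ {L a} ε → Separating L a → Consistent (witnessData L a ε)
    witnessData-consistent {L} {a} ε record { injective = injective ; avoids-anchors = avoids-anchors } q∈ q′∈ x≈y
      with classify q∈ | classify q′∈
      where
      classify : ∀ {q} → q ∈ witnessData L a ε →
        (∃ λ x → x ∈ anchors L × q ≡ (x , a)) ⊎ (∃ λ t → t ∈ L × q ≡ (eval (poly t) a , labelValue (ε t)))
      classify q∈ with ∈-++⁻ (map (_, a) (anchors L)) q∈
      ... | inj₁ q∈anchors = inj₁ (∈-map⁻ (_, a) q∈anchors)
      ... | inj₂ q∈labels  = inj₂ (∈-map⁻ _ q∈labels)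
    ... | inj₁ (_ , _ , refl)  | inj₁ (_ , _ , refl)  = ≈-refl
    ... | inj₂ (s , s∈ , refl) | inj₂ (t , t∈ , refl) = ≡⇒≈ (cong (labelValue ∘ ε) (injective s∈ t∈ x≈y))
    ... | inj₁ (x , x∈ , refl) | inj₂ (t , t∈ , refl) = contradiction (≈-sym x≈y) (avoids-anchors t∈ x∈)
    ... | inj₂ (t , t∈ , refl) | inj₁ (x , x∈ , refl) = contradiction x≈y (avoids-anchors t∈ x∈)

    ∃-witness : ∀ L (ε : Vertex → Bool) → length L < k →
      ∃ λ z → z ∉ L × (∀ {t} → t ∈ L → adjacent t z ≡ ε t)
    ∃-witness L ε short = z , (λ z∈L → otherClass z∈L refl) , adjacent-z
      where
      freeClass = ∃-∉ (map class L) (subst (_< k) (sym (length-map class L)) short)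
      separating = ∃-separating L short
      a = proj₁ separating
      open Separating (proj₂ separating)
      witness = ∃-vertex-interpolating (proj₁ freeClass) (witnessData L a ε)
                  (witnessData-consistent ε (proj₂ separating)) (length-witnessData L a ε short)
      z = proj₁ witness
      interpolates = All.++⁻ (map (_, a) (anchors L)) (proj₂ (proj₂ witness))

      otherClass : ∀ {t} → t ∈ L → class t ≢ class z
      otherClass t∈L same = proj₂ freeClass
        (subst (_∈ map class L) (trans same (proj₁ (proj₂ witness))) (∈-map⁺ class t∈L))

      z-at-anchor : ∀ {x} → x ∈ anchors L → eval (poly z) x ≈ a
      z-at-anchor = All.lookup (All.map⁻ (proj₁ interpolates))

      z-at-label : ∀ {t} → t ∈ L → eval (poly z) (eval (poly t) a) ≈ labelValue (ε t)
      z-at-label = All.lookup (All.map⁻ (proj₂ interpolates))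

      view-t-z : ∀ {t} → t ∈ L → view t z ≡ false
      view-t-z {t} t∈L = dec-false (_ ≈? 0) λ ≈0 → avoids-anchors t∈L (here refl) (≈-trans (eval-cong (poly t) z-at-name) ≈0)
        where z-at-name = ≈-sym (z-at-anchor (there (∈-map⁺ name t∈L)))

      view-z-t : ∀ {t} → t ∈ L → view z t ≡ ε t
      view-z-t {t} t∈L = bit-labelValue (ε t)
        (≈-trans (eval-cong (poly z) (eval-cong (poly t) (z-at-anchor (here refl)))) (z-at-label t∈L))

      adjacent-z : ∀ {t} → t ∈ L → adjacent t z ≡ ε t
      adjacent-z t∈L = trans (adjacent-otherClass (otherClass t∈L)) (cong₂ _xor_ (view-t-z t∈L) (view-z-t t∈L))

    H-extends : (X Y : Subset (k * p ^ D)) → Disjoint X Y → ∣ X ∪ Y ∣ < k →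
      ∃ λ z → z ∉ₛ X ∪ Y × (∀ x → x ∈ₛ X → adjacent x z ≡ true) × (∀ y → y ∈ₛ Y → adjacent y z ≡ false)
    H-extends X Y disjoint small =
      z , z∉L ∘ ∈-elements
        , (λ x x∈X → trans (adjacent-z (∈L (inj₁ x∈X))) (dec-true (x ∈ₛ? X) x∈X))
        , (λ y y∈Y → trans (adjacent-z (∈L (inj₂ y∈Y))) (dec-false (y ∈ₛ? X) λ y∈X → disjoint y y∈X y∈Y))
      where
      L = elements (X ∪ Y)
      ∈L : ∀ {x} → x ∈ₛ X ⊎ x ∈ₛ Y → x ∈ L
      ∈L = ∈-elements ∘ x∈p∪q⁺
      witness = ∃-witness L (λ t → does (t ∈ₛ? X)) (subst (_< k) (sym (length-elements (X ∪ Y))) small)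
      z = proj₁ witness
      z∉L = proj₁ (proj₂ witness)
      adjacent-z = proj₂ (proj₂ witness)

⊏-colourable : ∀ {F H c} → F ⊏ H → Colourable c H → Colourable c F
⊏-colourable (f , _ , adj-f) (colour , proper) = colour ∘ f , λ u v uv → proper (f u) (f v) (trans (adj-f u v) uv)

edgeless : ℕ → Graph
edgeless m = record { n = m ; adj = λ _ _ → false ; sym = λ _ _ → refl ; loopless = λ _ → refl }

∃-partite-extension-graph : ∀ k → Σ Graph λ H → EA k H × Colourable k H
∃-partite-extension-graph zero          = edgeless 0 , tt , (λ ()) , λ ()
∃-partite-extension-graph (suc zero)    = edgeless 1 , zero , (λ _ → zero) , λ _ _ ()
∃-partite-extension-graph k@(suc (suc _)) =
  let p , p-prime , p-large = ∃-prime> (k + badPointBound k)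
      open PartiteGraph k p-prime
      open Extension (≤-<-trans (m≤m+n k _) p-large) (≤-<-trans (m≤n+m _ k) p-large)
  in H , H-extends , H-colourable

theorem3p3 : (F : Graph) → 1 < n F →
    (χ : ℕ) → IsChromaticNumber χ F →
    (k : ℕ) → 1 ≤ k → Forces k F → χ ≤ k
theorem3p3 F _ χ (_ , minimal) k _ forces =
  let H , extends , colourable = ∃-partite-extension-graph k
  in minimal k (⊏-colourable {F} {H} (forces H extends) colourable)
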